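{- There are no games $X,Y$, both of type $\mathcal N$, such that $X+Y$ is of type $\mathcal P$.
   Context: A (finite impartial) game is defined recursively as a finite set of games, its options; $0$ is the game with no options. Three players alternate moves cyclically; a move replaces the current game by one of its options, and the player who makes the last move wins. The disjunctive sum $G+H$ is the game whose options are all $G'+H$ ($G'$ an option of $G$) and all $G+H'$ ($H'$ an option of $H$). Types are defined recursively: $G$ is of type $\mathcal N$ iff it has some option of type $\mathcal P$; of type $\mathcal O$ iff it has at least one option and all its options are of type $\mathcal N$; of type $\mathcal P$ iff all its options are of type $\mathcal O$ (so $0$ is of type $\mathcal P$); of type $\mathcal Q$ otherwise. -}

module Defs where

open import Data.List using (List; []; _∷_; _++_)
open import Data.Bool using (Bool; true; false; _∧_; _∨_; if_then_else_)

-- A finite impartial game: given by its (finite) list of options.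
-- (Order / repetition of options is irrelevant for everything below.)
data Game : Set where
  opts : List Game → Game

zeroG : Game
zeroG = opts []

data GType : Set where
  𝒩 𝒪 𝒫 𝒬 : GType

isN isO isP : GType → Bool
isN 𝒩 = true
isN _ = false
isO 𝒪 = true
isO _ = false
isP 𝒫 = true
isP _ = false

anyB allB : (GType → Bool) → List GType → Bool
anyB p [] = false
anyB p (t ∷ ts) = p t ∨ anyB p ts
allB p [] = true
allB p (t ∷ ts) = p t ∧ allB p ts

nonEmpty : List GType → Bool
nonEmpty [] = false
nonEmpty (_ ∷ _) = true

classify : List GType → GType
classify ts =
  if anyB isP ts then 𝒩
  else if nonEmpty ts ∧ allB isN ts then 𝒪
  else if allB isO ts then 𝒫
  else 𝒬

mutual
  type : Game → GType
  type (opts gs) = classify (types gs)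

  types : List Game → List GType
  types [] = []
  types (g ∷ gs) = type g ∷ types gs

mutual
  _⊕_ : Game → Game → Game
  G@(opts gs) ⊕ H@(opts hs) = opts (leftOpts gs H ++ rightOpts G hs)

  leftOpts : List Game → Game → List Game
  leftOpts [] H = []
  leftOpts (g ∷ gs) H = (g ⊕ H) ∷ leftOpts gs H

  rightOpts : Game → List Game → List Game
  rightOpts G [] = []
  rightOpts G (h ∷ hs) = (G ⊕ h) ∷ rightOpts G hs

infixl 6 _⊕_

-- An 𝒩 game X has a 𝒫 option X′, and if X + Y were 𝒫 then X′ + Y would be 𝒪. So it
-- suffices to show that 𝒫 + 𝒩 is never 𝒪. This is one of three impossibilities,
--   𝒫 + 𝒩 ≠ 𝒪,   𝒫 + 𝒫 ≠ 𝒩,   𝒫 + 𝒪 ≠ 𝒫   (and their mirror images),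
-- each of which yields a violation of the next one at an option of the sum:
-- a 𝒫 option of the 𝒩 summand, a 𝒫 option of the sum, an 𝒩 option of the 𝒪 summand.
-- All three therefore follow together by induction on the sum.
module Submission where

open import Defs
open import Data.Bool using (T; true; false; _∧_)
open import Data.Bool.Properties using (T-∧; T-∨)
open import Data.List using (List; []; _∷_; _++_; map)
open import Data.List.Membership.Propositional using (_∈_)
open import Data.List.Membership.Propositional.Properties using (∈-map⁺; ∈-map⁻; ∈-++⁺ˡ; ∈-++⁺ʳ; ∈-++⁻)
open import Data.List.Relation.Unary.Any using (here; there)
open import Data.Product using (_×_; _,_; proj₁; proj₂; ∃-syntax)
open import Data.Sum using (_⊎_; inj₁; inj₂)
import Data.Sum as Sum
open import Data.Unit using (tt)
open import Function using (flip; _∘_)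
open import Function.Bundles using (Equivalence)
open import Induction.WellFounded using (Acc; acc; WellFounded)
open import Relation.Binary.PropositionalEquality using (_≡_; _≢_; refl; sym; cong; cong₂; subst)
open import Relation.Nullary using (¬_)

open Equivalence using (to)

options : Game → List Game
options (opts gs) = gs

infix 4 _∈ₒ_

record _∈ₒ_ (g G : Game) : Set where
  constructor option
  field ∈-options : g ∈ options G

mutual
  ∈ₒ-wellFounded : WellFounded _∈ₒ_
  ∈ₒ-wellFounded (opts gs) = acc λ { (option g∈gs) → ∈-accessible gs g∈gs }

  ∈-accessible : ∀ gs {g} → g ∈ gs → Acc _∈ₒ_ g
  ∈-accessible (g ∷ gs) (here refl) = ∈ₒ-wellFounded g
  ∈-accessible (_ ∷ gs) (there g∈gs) = ∈-accessible gs g∈gs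

isN-sound : ∀ {t} → T (isN t) → t ≡ 𝒩
isN-sound {𝒩} _ = refl

isO-sound : ∀ {t} → T (isO t) → t ≡ 𝒪
isO-sound {𝒪} _ = refl

isP-sound : ∀ {t} → T (isP t) → t ≡ 𝒫
isP-sound {𝒫} _ = refl

anyB-types⁻ : ∀ p gs → T (anyB p (types gs)) → ∃[ g ] g ∈ gs × T (p (type g))
anyB-types⁻ p (g ∷ gs) h with to T-∨ h
... | inj₁ pg = g , here refl , pg
... | inj₂ h′ with anyB-types⁻ p gs h′
...   | g′ , g′∈gs , pg′ = g′ , there g′∈gs , pg′

allB-types⁻ : ∀ p gs → T (allB p (types gs)) → ∀ {g} → g ∈ gs → T (p (type g))
allB-types⁻ p (g ∷ gs) h (here refl) = proj₁ (to T-∧ h)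
allB-types⁻ p (g ∷ gs) h (there g′∈gs) = allB-types⁻ p gs (proj₂ (to T-∧ h)) g′∈gs

classify≡𝒩⁻ : ∀ ts → classify ts ≡ 𝒩 → T (anyB isP ts)
classify≡𝒩⁻ ts e with anyB isP ts | nonEmpty ts ∧ allB isN ts | allB isO ts
classify≡𝒩⁻ ts _  | true  | _     | _     = tt
classify≡𝒩⁻ ts () | false | true  | _
classify≡𝒩⁻ ts () | false | false | true
classify≡𝒩⁻ ts () | false | false | false

classify≡𝒪⁻ : ∀ ts → classify ts ≡ 𝒪 → T (nonEmpty ts ∧ allB isN ts)
classify≡𝒪⁻ ts e with anyB isP ts | nonEmpty ts ∧ allB isN ts | allB isO ts
classify≡𝒪⁻ ts () | true  | _     | _
classify≡𝒪⁻ ts _  | false | true  | _     = tt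
classify≡𝒪⁻ ts () | false | false | true
classify≡𝒪⁻ ts () | false | false | false

classify≡𝒫⁻ : ∀ ts → classify ts ≡ 𝒫 → T (allB isO ts)
classify≡𝒫⁻ ts e with anyB isP ts | nonEmpty ts ∧ allB isN ts | allB isO ts
classify≡𝒫⁻ ts () | true  | _     | _
classify≡𝒫⁻ ts () | false | true  | _
classify≡𝒫⁻ ts _  | false | false | true  = tt
classify≡𝒫⁻ ts () | false | false | false

𝒩⇒𝒫-option : ∀ G → type G ≡ 𝒩 → ∃[ g ] g ∈ₒ G × type g ≡ 𝒫
𝒩⇒𝒫-option (opts gs) e with anyB-types⁻ isP gs (classify≡𝒩⁻ (types gs) e)
... | g , g∈gs , pg = g , option g∈gs , isP-sound pg

𝒪⇒options-𝒩 : ∀ {G g} → type G ≡ 𝒪 → g ∈ₒ G → type g ≡ 𝒩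
𝒪⇒options-𝒩 {opts gs} e (option g∈gs) =
  isN-sound (allB-types⁻ isN gs (proj₂ (to T-∧ (classify≡𝒪⁻ (types gs) e))) g∈gs)

𝒪⇒𝒩-option : ∀ G → type G ≡ 𝒪 → ∃[ g ] g ∈ₒ G × type g ≡ 𝒩
𝒪⇒𝒩-option (opts []) ()
𝒪⇒𝒩-option (opts (g ∷ gs)) e = g , g∈G , 𝒪⇒options-𝒩 e g∈G
  where g∈G = option (here refl)

𝒫⇒options-𝒪 : ∀ {G g} → type G ≡ 𝒫 → g ∈ₒ G → type g ≡ 𝒪
𝒫⇒options-𝒪 {opts gs} e (option g∈gs) = isO-sound (allB-types⁻ isO gs (classify≡𝒫⁻ (types gs) e) g∈gs)

leftOpts≡map : ∀ xs Y → leftOpts xs Y ≡ map (_⊕ Y) xs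
leftOpts≡map []       Y = refl
leftOpts≡map (x ∷ xs) Y = cong (x ⊕ Y ∷_) (leftOpts≡map xs Y)

rightOpts≡map : ∀ X ys → rightOpts X ys ≡ map (X ⊕_) ys
rightOpts≡map X []       = refl
rightOpts≡map X (y ∷ ys) = cong (X ⊕ y ∷_) (rightOpts≡map X ys)

options-⊕ : ∀ X Y → options (X ⊕ Y) ≡ map (_⊕ Y) (options X) ++ map (X ⊕_) (options Y)
options-⊕ X@(opts xs) Y@(opts ys) = cong₂ _++_ (leftOpts≡map xs Y) (rightOpts≡map X ys)

-- Stating the lemmas below for any such operation makes the mirror images (𝒪 + 𝒫 ≠ 𝒫, …)
-- the instances at flip _⊕_, whose sums are literally the same games.
record IsDisjunctiveSum (_⊞_ : Game → Game → Game) : Set where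
  field
    left-option  : ∀ {X Y x} → x ∈ₒ X → x ⊞ Y ∈ₒ X ⊞ Y
    right-option : ∀ {X Y y} → y ∈ₒ Y → X ⊞ y ∈ₒ X ⊞ Y
    option⁻      : ∀ {X Y z} → z ∈ₒ X ⊞ Y →
                   (∃[ x ] x ∈ₒ X × z ≡ x ⊞ Y) ⊎ (∃[ y ] y ∈ₒ Y × z ≡ X ⊞ y)

open IsDisjunctiveSum

⊕-isDisjunctiveSum : IsDisjunctiveSum _⊕_
⊕-isDisjunctiveSum = record
  { left-option  = λ {X} {Y} (option x∈X) →
      option (subst (_ ∈_) (sym (options-⊕ X Y)) (∈-++⁺ˡ (∈-map⁺ (_⊕ Y) x∈X)))
  ; right-option = λ {X} {Y} (option y∈Y) →
      option (subst (_ ∈_) (sym (options-⊕ X Y)) (∈-++⁺ʳ _ (∈-map⁺ (X ⊕_) y∈Y)))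
  ; option⁻      = ⊕-option⁻
  }
  where
  ⊕-option⁻ : ∀ {X Y z} → z ∈ₒ X ⊕ Y → (∃[ x ] x ∈ₒ X × z ≡ x ⊕ Y) ⊎ (∃[ y ] y ∈ₒ Y × z ≡ X ⊕ y)
  ⊕-option⁻ {X} {Y} (option z∈X⊕Y) with ∈-++⁻ _ (subst (_ ∈_) (options-⊕ X Y) z∈X⊕Y)
  ... | inj₁ z∈xs⊕Y = let x , x∈X , z≡x⊕Y = ∈-map⁻ (_⊕ Y) z∈xs⊕Y in inj₁ (x , option x∈X , z≡x⊕Y)
  ... | inj₂ z∈X⊕ys = let y , y∈Y , z≡X⊕y = ∈-map⁻ (X ⊕_) z∈X⊕ys in inj₂ (y , option y∈Y , z≡X⊕y)

flip-isDisjunctiveSum : ∀ {_⊞_} → IsDisjunctiveSum _⊞_ → IsDisjunctiveSum (flip _⊞_)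
flip-isDisjunctiveSum S = record
  { left-option  = right-option S
  ; right-option = left-option S
  ; option⁻      = Sum.swap ∘ option⁻ S
  }

mutual
  𝒫⊞𝒩≢𝒪 : ∀ {_⊞_} → IsDisjunctiveSum _⊞_ → ∀ {X Y} → Acc _∈ₒ_ (X ⊞ Y) →
          type X ≡ 𝒫 → type Y ≡ 𝒩 → type (X ⊞ Y) ≢ 𝒪
  𝒫⊞𝒩≢𝒪 S {Y = Y} (acc rs) tX tY tX⊞Y =
    let y , y∈Y , ty = 𝒩⇒𝒫-option Y tY
        X⊞y∈X⊞Y = right-option S y∈Y
    in 𝒫⊞𝒫≢𝒩 S (rs X⊞y∈X⊞Y) tX ty (𝒪⇒options-𝒩 tX⊞Y X⊞y∈X⊞Y)

  𝒫⊞𝒫≢𝒩 : ∀ {_⊞_} → IsDisjunctiveSum _⊞_ → ∀ {X Y} → Acc _∈ₒ_ (X ⊞ Y) →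
          type X ≡ 𝒫 → type Y ≡ 𝒫 → type (X ⊞ Y) ≢ 𝒩
  𝒫⊞𝒫≢𝒩 S (acc rs) tX tY tX⊞Y with 𝒩⇒𝒫-option _ tX⊞Y
  ... | z , z∈X⊞Y , tz with option⁻ S z∈X⊞Y
  ...   | inj₁ (x , x∈X , refl) =
    𝒫⊞𝒪≢𝒫 (flip-isDisjunctiveSum S) (rs z∈X⊞Y) tY (𝒫⇒options-𝒪 tX x∈X) tz
  ...   | inj₂ (y , y∈Y , refl) =
    𝒫⊞𝒪≢𝒫 S (rs z∈X⊞Y) tX (𝒫⇒options-𝒪 tY y∈Y) tz

  𝒫⊞𝒪≢𝒫 : ∀ {_⊞_} → IsDisjunctiveSum _⊞_ → ∀ {X Y} → Acc _∈ₒ_ (X ⊞ Y) →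
          type X ≡ 𝒫 → type Y ≡ 𝒪 → type (X ⊞ Y) ≢ 𝒫
  𝒫⊞𝒪≢𝒫 S {Y = Y} (acc rs) tX tY tX⊞Y =
    let y , y∈Y , ty = 𝒪⇒𝒩-option Y tY
        X⊞y∈X⊞Y = right-option S y∈Y
    in 𝒫⊞𝒩≢𝒪 S (rs X⊞y∈X⊞Y) tX ty (𝒫⇒options-𝒪 tX⊞Y X⊞y∈X⊞Y)

claim3 : (X Y : Game) → type X ≡ 𝒩 → type Y ≡ 𝒩 → ¬ (type (X ⊕ Y) ≡ 𝒫)
claim3 X Y tX tY tX⊕Y =
  let x , x∈X , tx = 𝒩⇒𝒫-option X tX
      x⊕Y∈X⊕Y = left-option ⊕-isDisjunctiveSum x∈X
  in 𝒫⊞𝒩≢𝒪 ⊕-isDisjunctiveSum (∈ₒ-wellFounded (x ⊕ Y)) tx tY (𝒫⇒options-𝒪 tX⊕Y x⊕Y∈X⊕Y)
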